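{- For every integer $k\geq 2$ there is a positive integer $\delta_k$ such that every finite simple undirected graph $G$ of minimum degree at least $\delta_k$ has a $\frac{1}{k}$-majority $(k+1)$-edge-coloring, i.e., an edge-coloring $c:E(G)\to\{1,\dots,k+1\}$ such that for every vertex $u$ of $G$ and every color $\alpha$, at most $\frac{1}{k}d_G(u)$ of the edges incident with $u$ have color $\alpha$.
   Context: For $\alpha\in(0,1)$, an $\alpha$-majority $m$-edge-coloring of a graph $G$ is an edge-coloring $c:E(G)\to\{1,\dots,m\}$ such that, for every vertex $u$ and every color, at most $\alpha\, d_G(u)$ of the edges incident with $u$ have that color; $d_G(u)$ denotes the degree of $u$. -}

module Defs where

open import Data.Nat using (ℕ; suc; _+_; _*_; _≤_)
open import Data.Bool using (Bool; true; false; T; _∧_)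
open import Data.Fin using (Fin)
open import Data.Fin.Properties using () renaming (_≟_ to _≟ᶠ_)
open import Data.List using (List; length; filter)
open import Data.List.Base using (allFin)
open import Relation.Nullary.Decidable using (⌊_⌋)
open import Relation.Binary.PropositionalEquality using (_≡_)
open import Relation.Nullary using (¬_; yes; no)
open import Data.Bool using (T?)

record SimpleGraph (n : ℕ) : Set where
  field
    adj      : Fin n → Fin n → Bool
    symmetric : ∀ u v → adj u v ≡ adj v u
    loopless : ∀ u → adj u u ≡ false

open SimpleGraph public

neighbours : ∀ {n} → SimpleGraph n → Fin n → List (Fin n)
neighbours G u = filter (λ v → T? (adj G u v)) (allFin _)

degree : ∀ {n} → SimpleGraph n → Fin n → ℕ
degree G u = length (neighbours G u)

MinDegreeAtLeast : ∀ {n} → SimpleGraph n → ℕ → Set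
MinDegreeAtLeast G δ = ∀ u → δ ≤ degree G u

record EdgeColoring {n} (G : SimpleGraph n) (m : ℕ) : Set where
  field
    col       : (u v : Fin n) → T (adj G u v) → Fin m
    col-sym   : ∀ u v (e : T (adj G u v)) (e' : T (adj G v u)) → col u v e ≡ col v u e'

open EdgeColoring public

hasColor : ∀ {n m} {G : SimpleGraph n} → EdgeColoring G m → Fin n → Fin m → Fin n → Bool
hasColor {G = G} c u a v with T? (adj G u v)
... | yes e = ⌊ col c u v e ≟ᶠ a ⌋
... | no _  = false

colorDegree : ∀ {n m} {G : SimpleGraph n} → EdgeColoring G m → Fin n → Fin m → ℕ
colorDegree {n} c u a = length (filter (λ v → T? (hasColor c u a v)) (allFin n))

-- α-majority with α = 1/k: for every vertex u and color a,
-- (#edges at u of color a) ≤ (1/k)·d(u), i.e. k · #(...) ≤ d(u).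
IsMajorityColoring : ∀ {n m} {G : SimpleGraph n} → ℕ → EdgeColoring G m → Set
IsMajorityColoring {G = G} k c = ∀ u a → k * colorDegree c u a ≤ degree G u

-- Every finite multigraph has an orientation in which in- and
-- out-degree differ by at most one at each vertex: shortcut a path x–y–z to an
-- edge x–z, orient by induction, and subdivide again. Orienting the bipartite
-- double cover in this way and colouring each edge by the direction of its copy
-- gives a 2-edge-colouring whose two colour degrees differ by at most 2 at every
-- vertex. Recursing into both colour classes j times yields 2^j colours, each of
-- degree at most (d + 2^(j+1)) / 2^j at a vertex of degree d. Finally group the
-- N = 2^((k+1)²) colours into k + 1 blocks of B = ⌊N/(k+1)⌋ + 1 consecutive ones:
-- a block has degree at most B (d + 2N) / N, and since kB < N this is at most d/k
-- once d > 2kBN.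
module Submission where

open import Defs
open import Data.Bool using (Bool; true; false; if_then_else_; not; _∧_)
open import Data.Bool.Properties using (T?; ∧-identityʳ)
open import Data.Empty using (⊥-elim)
open import Data.Fin using (Fin; zero; suc; toℕ; fromℕ<)
open import Data.Fin.Properties using (toℕ-fromℕ<; toℕ-injective; <-cmp; <-asym; _<?_) renaming (_≟_ to _≟ᶠ_)
open import Data.List using (List; []; _∷_; _++_; map; filter; length; tabulate; cartesianProduct; allFin)
open import Data.List.Properties using (map-cong-local)
open import Data.List.Relation.Binary.Pointwise using (Pointwise; []; _∷_)
import Data.List.Relation.Binary.Pointwise as Pointwise
open import Data.List.Relation.Unary.All using (All; []; _∷_)
import Data.List.Relation.Unary.All as All
open import Data.List.Relation.Unary.AllPairs using ([]; _∷_)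
open import Data.List.Relation.Unary.Unique.Propositional using (Unique)
import Data.List.Relation.Unary.Unique.Propositional.Properties as Unique
open import Data.Nat using (ℕ; zero; suc; _+_; _*_; _^_; _/_; _%_; _≤_; _<_; z≤n; s≤s; NonZero; >-nonZero)
open import Data.Nat.DivMod using (m≡m%n+[m/n]*n; m%n<n; m*n/n≡m; /-mono-≤; m<n*o⇒m/o<n; m/n*n≤m)
open import Data.Nat.Properties
  using (+-assoc; +-comm; +-identityʳ; +-suc; *-comm; *-identityˡ; *-identityʳ; *-zeroʳ; *-suc;
         ≤-refl; ≤-reflexive; ≤-trans; ≤-total; <-trans; <-≤-trans; <⇒≤; n≤1+n; m≤m+n; m^n>0; even≢odd;
         +-mono-≤; +-monoˡ-≤; +-monoʳ-≤; +-monoˡ-<; *-monoʳ-≤; *-monoˡ-≤; +-cancelʳ-≤; *-cancelˡ-≤; *-cancelˡ-≡;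
         +-commutativeSemigroup; +-*-semiring; module ≤-Reasoning)
  renaming (_≟_ to _≟ℕ_)
open import Data.Nat.Solver using (module +-*-Solver)
open import Data.Product using (Σ; ∃; ∃₂; _×_; _,_; proj₁; proj₂; swap)
import Data.Product.Properties as ×
open import Data.Sum using (_⊎_; inj₁; inj₂)
import Data.Sum.Properties as ⊎
open import Function using (_∘_; id; mk⇔)
open import Relation.Binary.Definitions using (DecidableEquality; tri<; tri≈; tri>)
open import Relation.Binary.PropositionalEquality
open import Relation.Nullary using (does; yes; no)
open import Relation.Nullary.Decidable using (dec-true; dec-false; does-⇔; isYes≗does)
open import Algebra.Properties.Semiring.Sum +-*-semiring
  using (sum-syntax; sum-remove; sum-cong-≗; sum-replicate-zero; ∑-distrib-+; *-distribˡ-sum)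

open import Algebra.Properties.CommutativeSemigroup +-commutativeSemigroup using (interchange; x∙yz≈y∙xz; xy∙z≈xz∙y)
open +-*-Solver using (solve; _:+_; _:*_; con; _:=_)

𝟙 : Bool → ℕ
𝟙 true  = 1
𝟙 false = 0

∑ˡ : {A : Set} → List A → (A → ℕ) → ℕ
∑ˡ []       f = 0
∑ˡ (x ∷ xs) f = f x + ∑ˡ xs f

infixl 10 ∑ˡ
syntax ∑ˡ xs (λ x → e) = ∑[ x ∈ xs ] e

private variable
  A A′ : Set

∑ˡ-++ : (f : A → ℕ) (xs ys : List A) → ∑[ x ∈ xs ++ ys ] f x ≡ ∑[ x ∈ xs ] f x + ∑[ x ∈ ys ] f x
∑ˡ-++ f []       ys = refl
∑ˡ-++ f (x ∷ xs) ys = trans (cong (f x +_) (∑ˡ-++ f xs ys)) (sym (+-assoc (f x) _ _))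

∑ˡ-cong : {f g : A → ℕ} → f ≗ g → (xs : List A) → ∑[ x ∈ xs ] f x ≡ ∑[ x ∈ xs ] g x
∑ˡ-cong f≗g []       = refl
∑ˡ-cong f≗g (x ∷ xs) = cong₂ _+_ (f≗g x) (∑ˡ-cong f≗g xs)

∑ˡ-mono-≤ : {f g : A → ℕ} → (∀ x → f x ≤ g x) → (xs : List A) → ∑[ x ∈ xs ] f x ≤ ∑[ x ∈ xs ] g x
∑ˡ-mono-≤ f≤g []       = z≤n
∑ˡ-mono-≤ f≤g (x ∷ xs) = +-mono-≤ (f≤g x) (∑ˡ-mono-≤ f≤g xs)

∑ˡ-distrib-+ : (f g : A → ℕ) (xs : List A) → ∑[ x ∈ xs ] (f x + g x) ≡ ∑[ x ∈ xs ] f x + ∑[ x ∈ xs ] g x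
∑ˡ-distrib-+ f g []       = refl
∑ˡ-distrib-+ f g (x ∷ xs) = trans (cong (f x + g x +_) (∑ˡ-distrib-+ f g xs)) (interchange (f x) (g x) _ _)

∑ˡ-splice : (f : A → ℕ) (a b c : A) (d : ℕ) (xs ys : List A) → f a + f b ≡ f c + d →
            ∑[ x ∈ a ∷ xs ++ b ∷ ys ] f x ≡ ∑[ x ∈ c ∷ xs ++ ys ] f x + d
∑ˡ-splice f a b c d xs ys ab≡c+d = begin
  f a + ∑[ x ∈ xs ++ b ∷ ys ] f x        ≡⟨ cong (f a +_) (∑ˡ-++ f xs (b ∷ ys)) ⟩
  f a + (X + (f b + Y))                  ≡⟨ cong (f a +_) (x∙yz≈y∙xz X (f b) Y) ⟩
  f a + (f b + (X + Y))                  ≡⟨ sym (+-assoc (f a) (f b) _) ⟩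
  (f a + f b) + (X + Y)                  ≡⟨ cong (_+ (X + Y)) ab≡c+d ⟩
  (f c + d) + (X + Y)                    ≡⟨ xy∙z≈xz∙y (f c) d _ ⟩
  f c + (X + Y) + d                      ≡⟨ cong (λ s → f c + s + d) (sym (∑ˡ-++ f xs ys)) ⟩
  f c + ∑[ x ∈ xs ++ ys ] f x + d        ∎
  where
  open ≡-Reasoning
  X = ∑[ x ∈ xs ] f x
  Y = ∑[ x ∈ ys ] f x

∑ˡ-filter : (P : A → Bool) (f : A → ℕ) (xs : List A) →
            ∑[ x ∈ filter (T? ∘ P) xs ] f x ≡ ∑[ x ∈ xs ] (if P x then f x else 0)
∑ˡ-filter P f []       = refl
∑ˡ-filter P f (x ∷ xs) with P x
... | true  = cong (f x +_) (∑ˡ-filter P f xs)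
... | false = ∑ˡ-filter P f xs

length-filter : (P : A → Bool) (xs : List A) → length (filter (T? ∘ P) xs) ≡ ∑[ x ∈ xs ] 𝟙 (P x)
length-filter P []       = refl
length-filter P (x ∷ xs) with P x
... | true  = cong suc (length-filter P xs)
... | false = length-filter P xs

∑ˡ-map : (g : A′ → A) (f : A → ℕ) (xs : List A′) → ∑[ x ∈ map g xs ] f x ≡ ∑[ x ∈ xs ] f (g x)
∑ˡ-map g f []       = refl
∑ˡ-map g f (x ∷ xs) = cong (f (g x) +_) (∑ˡ-map g f xs)

∑ˡ-tabulate : ∀ {n} (g : Fin n → A) (f : A → ℕ) → ∑[ x ∈ tabulate g ] f x ≡ ∑[ i < n ] f (g i)
∑ˡ-tabulate {n = zero}  g f = refl
∑ˡ-tabulate {n = suc n} g f = cong (f (g zero) +_) (∑ˡ-tabulate (g ∘ suc) f)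

∑ˡ-cartesianProduct : (f : A × A′ → ℕ) (xs : List A) (ys : List A′) →
  ∑[ p ∈ cartesianProduct xs ys ] f p ≡ ∑[ x ∈ xs ] ∑[ y ∈ ys ] f (x , y)
∑ˡ-cartesianProduct f []       ys = refl
∑ˡ-cartesianProduct f (x ∷ xs) ys =
  trans (∑ˡ-++ f (map (x ,_) ys) _) (cong₂ _+_ (∑ˡ-map (x ,_) f ys) (∑ˡ-cartesianProduct f xs ys))

∑ˡ-∑-comm : ∀ {m} (f : A → Fin m → ℕ) (xs : List A) →
            ∑[ x ∈ xs ] ∑[ i < m ] f x i ≡ ∑[ i < m ] ∑[ x ∈ xs ] f x i
∑ˡ-∑-comm {m = m} f []       = sym (sum-replicate-zero m)
∑ˡ-∑-comm           f (x ∷ xs) = trans (cong (∑[ i < _ ] f x i +_) (∑ˡ-∑-comm f xs)) (sym (∑-distrib-+ (f x) _))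

length-filter-allFin : ∀ {n} (P : Fin n → Bool) → length (filter (T? ∘ P) (allFin n)) ≡ ∑[ i < n ] 𝟙 (P i)
length-filter-allFin P = trans (length-filter P (allFin _)) (∑ˡ-tabulate id (𝟙 ∘ P))

term≤∑ : ∀ {n} (f : Fin n → ℕ) i → f i ≤ ∑[ j < n ] f j
term≤∑ {suc n} f i = subst (f i ≤_) (sym (sum-remove f)) (m≤m+n _ _)

∑-bounded : ∀ {n} (f : Fin n → ℕ) K → (∀ i → f i ≤ K) → ∑[ i < n ] f i ≤ n * K
∑-bounded {zero}  f K _  = z≤n
∑-bounded {suc n} f K f≤ = +-mono-≤ (f≤ zero) (∑-bounded (f ∘ suc) K (f≤ ∘ suc))

∑-δ : ∀ {n} (u : Fin n) (h : Fin n → ℕ) → ∑[ x < n ] (𝟙 (does (x ≟ᶠ u)) * h x) ≡ h u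
∑-δ {suc n} zero    h = trans (cong₂ _+_ (+-identityʳ (h zero)) (sum-replicate-zero n)) (+-identityʳ _)
∑-δ {suc n} (suc u) h = ∑-δ u (h ∘ suc)

Near : ℕ → ℕ → ℕ → Set
Near d a b = a ≤ d + b × b ≤ d + a

Near-+ : ∀ {d d' a a' b b'} → Near d a b → Near d' a' b' → Near (d + d') (a + a') (b + b')
Near-+ {d} {d'} {a} {a'} {b} {b'} (a≤ , b≤) (a'≤ , b'≤) =
  ≤-trans (+-mono-≤ a≤ a'≤) (≤-reflexive (interchange d b d' b')) ,
  ≤-trans (+-mono-≤ b≤ b'≤) (≤-reflexive (interchange d a d' a'))

Near-+ʳ : ∀ {d a b} c → Near d a b → Near d (a + c) (b + c)
Near-+ʳ {d} {a} {b} c (a≤ , b≤) =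
  ≤-trans (+-monoˡ-≤ c a≤) (≤-reflexive (+-assoc d b c)) ,
  ≤-trans (+-monoˡ-≤ c b≤) (≤-reflexive (+-assoc d a c))

parity : ∀ c → ∃ λ h → c ≡ 2 * h ⊎ c ≡ suc (2 * h)
parity zero    = 0 , inj₁ refl
parity (suc c) with parity c
... | h , inj₁ refl = h , inj₂ refl
... | h , inj₂ refl = suc h , inj₁ (cong suc (sym (+-suc h (h + 0))))

2*-≟ : ∀ a b → does (2 * a ≟ℕ 2 * b) ≡ does (a ≟ℕ b)
2*-≟ a b = does-⇔ (mk⇔ (*-cancelˡ-≡ a b 2) (cong (2 *_))) (2 * a ≟ℕ 2 * b) (a ≟ℕ b)

m<n⇒1+2m<2n : ∀ {a b} → a < b → suc (2 * a) < 2 * b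
m<n⇒1+2m<2n {a} {b} a<b = subst (_≤ 2 * b) (*-suc 2 a) (*-monoʳ-≤ 2 a<b)

halving-step : ∀ m x t f → m * x + 2 ≤ t + 2 * m → t ≤ 2 + f → 2 * m * x + 2 ≤ (t + f) + 2 * (2 * m)
halving-step m x t f mx≤ t≤ = +-cancelʳ-≤ 2 _ _ (begin
  2 * m * x + 2 + 2          ≡⟨ solve 2 (λ m x → con 2 :* m :* x :+ con 2 :+ con 2 := con 2 :* (m :* x :+ con 2)) refl m x ⟩
  2 * (m * x + 2)            ≤⟨ *-monoʳ-≤ 2 mx≤ ⟩
  2 * (t + 2 * m)            ≡⟨ solve 2 (λ t m → con 2 :* (t :+ con 2 :* m) := t :+ t :+ con 2 :* (con 2 :* m)) refl t m ⟩
  t + t + 2 * (2 * m)        ≤⟨ +-monoˡ-≤ (2 * (2 * m)) (+-monoʳ-≤ t t≤) ⟩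
  t + (2 + f) + 2 * (2 * m)  ≡⟨ solve 3 (λ t f m → t :+ (con 2 :+ f) :+ con 2 :* (con 2 :* m)
                                               := t :+ f :+ con 2 :* (con 2 :* m) :+ con 2) refl t f m ⟩
  t + f + 2 * (2 * m) + 2    ∎)
  where open ≤-Reasoning

block-bound : ∀ c a B .{{_ : NonZero B}} w →
  (if does (c / B ≟ℕ a) then w else 0) ≤ ∑[ i < B ] (if does (c ≟ℕ a * B + toℕ i) then w else 0)
block-bound c a B w with c / B ≟ℕ a
... | no c/B≢a rewrite dec-false (c / B ≟ℕ a) c/B≢a = z≤n
... | yes refl rewrite dec-true (c / B ≟ℕ c / B) refl = subst (_≤ ∑[ i < B ] term i) remainder-term (term≤∑ term r)
  where
  term : Fin B → ℕ
  term i = if does (c ≟ℕ c / B * B + toℕ i) then w else 0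
  r : Fin B
  r = fromℕ< (m%n<n c B)
  remainder-term : term r ≡ w
  remainder-term rewrite toℕ-fromℕ< (m%n<n c B)
                       | dec-true (c ≟ℕ c / B * B + c % B) (trans (m≡m%n+[m/n]*n c B) (+-comm (c % B) _)) = refl

n<2^n : ∀ n → n < 2 ^ n
n<2^n zero    = s≤s z≤n
n<2^n (suc n) = ≤-trans (≤-reflexive (cong suc (+-comm 1 n)))
                        (+-mono-≤ (n<2^n n) (subst (1 ≤_) (sym (*-identityˡ _)) (m^n>0 2 n)))

majority-arith : ∀ {k B N C D} → N * C ≤ B * (D + 2 * N) → k * B < N → k * B * (2 * N) < D → k * C ≤ D
majority-arith {k} {B} {N} {C} {D} NC≤ kB<N 2kBN<D = *-cancelˡ-≤ N {{>-nonZero (<-≤-trans (s≤s z≤n) kB<N)}} (begin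
  N * (k * C)                  ≡⟨ solve 3 (λ N k C → N :* (k :* C) := k :* (N :* C)) refl N k C ⟩
  k * (N * C)                  ≤⟨ *-monoʳ-≤ k NC≤ ⟩
  k * (B * (D + 2 * N))        ≡⟨ solve 4 (λ k B D N → k :* (B :* (D :+ con 2 :* N))
                                                   := k :* B :* D :+ k :* B :* (con 2 :* N)) refl k B D N ⟩
  k * B * D + k * B * (2 * N)  ≤⟨ +-monoʳ-≤ (k * B * D) (≤-trans (n≤1+n _) 2kBN<D) ⟩
  k * B * D + D                ≡⟨ solve 3 (λ k B D → k :* B :* D :+ D := (con 1 :+ k :* B) :* D) refl k B D ⟩
  suc (k * B) * D              ≤⟨ *-monoˡ-≤ D kB<N ⟩
  N * D                        ∎)
  where open ≤-Reasoning

module Parameters (k : ℕ) where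

  N : ℕ
  N = 2 ^ (suc k * suc k)

  B : ℕ
  B = suc (N / suc k)

  threshold : ℕ
  threshold = suc (k * B * (2 * N))

  quotient< : ∀ {c} → c < N → c / B < suc k
  quotient< {c} c<N = m<n*o⇒m/o<n (<-trans c<N N<)
    where
    N< : N < suc k * B
    N< = begin-strict
      N                               ≡⟨ m≡m%n+[m/n]*n N (suc k) ⟩
      N % suc k + N / suc k * suc k   <⟨ +-monoˡ-< _ (m%n<n N (suc k)) ⟩
      suc k + N / suc k * suc k       ≡⟨ cong (suc k +_) (*-comm (N / suc k) (suc k)) ⟩
      suc k + suc k * (N / suc k)     ≡⟨ *-suc (suc k) (N / suc k) ⟨
      suc k * B                       ∎
      where open ≤-Reasoning

  k*B<N : k * B < N
  k*B<N = begin-strict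
    k * B                      ≡⟨ *-suc k q ⟩
    k + k * q                  <⟨ +-monoˡ-≤ (k * q) k<q ⟩
    q + k * q                  ≡⟨ *-comm (suc k) q ⟩
    q * suc k                  ≤⟨ m/n*n≤m N (suc k) ⟩
    N                          ∎
    where
    open ≤-Reasoning
    q = N / suc k
    k<q : k < q
    k<q = subst (_≤ q) (m*n/n≡m (suc k) (suc k)) (/-mono-≤ (<⇒≤ (n<2^n (suc k * suc k))) (≤-refl {suc k}))

module Multigraph {V : Set} (_≟_ : DecidableEquality V) where

  Edge : Set
  Edge = V × V

  _≐_ : V → V → Bool
  a ≐ b = does (a ≟ b)

  outdeg indeg : List Edge → V → ℕ
  outdeg O v = ∑[ e ∈ O ] 𝟙 (proj₁ e ≐ v)
  indeg  O v = ∑[ e ∈ O ] 𝟙 (proj₂ e ≐ v)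

  inc : V → Edge → ℕ
  inc v e = 𝟙 (proj₁ e ≐ v) + 𝟙 (proj₂ e ≐ v)

  deg[_] : (Edge → Bool) → List Edge → V → ℕ
  deg[ P ] E v = ∑[ e ∈ E ] (if P e then inc v e else 0)

  deg : List Edge → V → ℕ
  deg = deg[ (λ _ → true) ]

  _⁻¹_ : (Edge → ℕ) → ℕ → Edge → Bool
  (χ ⁻¹ c) e = does (χ e ≟ℕ c)

  _⁻¹ᶠ_ : ∀ {m} → (Edge → Fin m) → Fin m → Edge → Bool
  (μ ⁻¹ᶠ a) e = does (μ e ≟ᶠ a)

  deg[]-cong : ∀ {P Q} → P ≗ Q → ∀ E v → deg[ P ] E v ≡ deg[ Q ] E v
  deg[]-cong P≗Q E v = ∑ˡ-cong (λ e → cong (λ b → if b then inc v e else 0) (P≗Q e)) E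

  deg[]≤deg : ∀ P E v → deg[ P ] E v ≤ deg E v
  deg[]≤deg P E v = ∑ˡ-mono-≤ le E
    where
    le : ∀ e → (if P e then inc v e else 0) ≤ inc v e
    le e with P e
    ... | true  = ≤-refl
    ... | false = z≤n

  deg-split : ∀ P E v → deg E v ≡ deg[ P ] E v + deg[ not ∘ P ] E v
  deg-split P E v = trans (∑ˡ-cong split E) (∑ˡ-distrib-+ _ _ E)
    where
    split : ∀ e → inc v e ≡ (if P e then inc v e else 0) + (if not (P e) then inc v e else 0)
    split e with P e
    ... | true  = sym (+-identityʳ _)
    ... | false = refl

  deg-filter : ∀ Q E v → deg (filter (T? ∘ Q) E) v ≡ deg[ Q ] E v
  deg-filter Q E v = ∑ˡ-filter Q (inc v) E

  deg[]-filter : ∀ P Q E v → deg[ P ] (filter (T? ∘ Q) E) v ≡ deg[ (λ e → Q e ∧ P e) ] E v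
  deg[]-filter P Q E v = trans (∑ˡ-filter Q _ E) (∑ˡ-cong both E)
    where
    both : ∀ e → (if Q e then (if P e then inc v e else 0) else 0) ≡ (if Q e ∧ P e then inc v e else 0)
    both e with Q e
    ... | true  = refl
    ... | false = refl

  Balanced : List Edge → Set
  Balanced O = ∀ v → Near 1 (outdeg O v) (indeg O v)

  SameEnds : Edge → Edge → Set
  SameEnds e o = o ≡ e ⊎ o ≡ swap e

  SameEnds-sym : ∀ {a b} → SameEnds a b → SameEnds b a
  SameEnds-sym (inj₁ refl) = inj₁ refl
  SameEnds-sym (inj₂ refl) = inj₂ refl

  SameEnds-swap : ∀ {a b} → SameEnds a b → SameEnds b (swap a)
  SameEnds-swap (inj₁ refl) = inj₂ refl
  SameEnds-swap (inj₂ refl) = inj₁ refl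

  Reorientation : List Edge → List Edge → Set
  Reorientation = Pointwise SameEnds

  Avoids : V → Edge → Set
  Avoids y e = proj₁ e ≢ y × proj₂ e ≢ y

  data Meets (y : V) : List Edge → Set where
    meets : ∀ A z {e} B → SameEnds (y , z) e → Meets y (A ++ e ∷ B)

  meets? : ∀ y E → All (Avoids y) E ⊎ Meets y E
  meets? y []            = inj₁ []
  meets? y ((a , b) ∷ E) with a ≟ y | b ≟ y
  ... | yes refl | _        = inj₂ (meets [] b E (inj₁ refl))
  ... | no _     | yes refl = inj₂ (meets [] a E (inj₂ refl))
  ... | no a≢y   | no b≢y   with meets? y E
  ...   | inj₁ avoid            = inj₁ ((a≢y , b≢y) ∷ avoid)
  ...   | inj₂ (meets A z B r) = inj₂ (meets ((a , b) ∷ A) z B r)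

  𝟙-≢ : ∀ {a v} → a ≢ v → 𝟙 (a ≐ v) ≡ 0
  𝟙-≢ {a} {v} a≢v = cong 𝟙 (dec-false (a ≟ v) a≢v)

  outdeg-avoided : ∀ {y O} → All (Avoids y) O → outdeg O y ≡ 0
  outdeg-avoided []              = refl
  outdeg-avoided ((a≢ , _) ∷ av) = cong₂ _+_ (𝟙-≢ a≢) (outdeg-avoided av)

  indeg-avoided : ∀ {y O} → All (Avoids y) O → indeg O y ≡ 0
  indeg-avoided []              = refl
  indeg-avoided ((_ , b≢) ∷ av) = cong₂ _+_ (𝟙-≢ b≢) (indeg-avoided av)

  Reorientation-avoids : ∀ {y E O} → Reorientation E O → All (Avoids y) E → All (Avoids y) O
  Reorientation-avoids []               []              = []
  Reorientation-avoids (inj₁ refl ∷ rs) (av ∷ avs)      = av ∷ Reorientation-avoids rs avs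
  Reorientation-avoids (inj₂ refl ∷ rs) ((p , q) ∷ avs) = (q , p) ∷ Reorientation-avoids rs avs

  Reorientation-++⁻ : ∀ A {B O} → Reorientation (A ++ B) O →
    ∃₂ λ OA OB → O ≡ OA ++ OB × Reorientation A OA × Reorientation B OB
  Reorientation-++⁻ []      rs       = [] , _ , refl , [] , rs
  Reorientation-++⁻ (a ∷ A) (r ∷ rs) with Reorientation-++⁻ A rs
  ... | OA , OB , refl , ra , rb = _ ∷ OA , OB , refl , r ∷ ra , rb

  Balanced-∷ : ∀ O {s t} → Balanced O → outdeg O s ≤ indeg O s → indeg O t ≤ outdeg O t →
               Balanced ((s , t) ∷ O)
  Balanced-∷ O {s} {t} bal s-out≤in t-in≤out v with s ≟ v | t ≟ v
  ... | no _     | no _     = bal v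
  ... | yes refl | no _     = s≤s s-out≤in , ≤-trans (proj₂ (bal v)) (n≤1+n _)
  ... | no _     | yes refl = ≤-trans (proj₁ (bal v)) (n≤1+n _) , s≤s t-in≤out
  ... | yes refl | yes refl = s≤s (proj₁ (bal v)) , s≤s (proj₂ (bal v))

  Balanced-splice : ∀ a b c y OA OB →
    (∀ v → 𝟙 (proj₁ a ≐ v) + 𝟙 (proj₁ b ≐ v) ≡ 𝟙 (proj₁ c ≐ v) + 𝟙 (y ≐ v)) →
    (∀ v → 𝟙 (proj₂ a ≐ v) + 𝟙 (proj₂ b ≐ v) ≡ 𝟙 (proj₂ c ≐ v) + 𝟙 (y ≐ v)) →
    Balanced (c ∷ OA ++ OB) → Balanced (a ∷ OA ++ b ∷ OB)
  Balanced-splice a b c y OA OB out≡ in≡ bal v =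
    subst₂ (Near 1)
      (sym (∑ˡ-splice (λ e → 𝟙 (proj₁ e ≐ v)) a b c _ OA OB (out≡ v)))
      (sym (∑ˡ-splice (λ e → 𝟙 (proj₂ e ≐ v)) a b c _ OA OB (in≡ v)))
      (Near-+ʳ {d = 1} (𝟙 (y ≐ v)) (bal v))

  private
    length-++-∷ : ∀ {A : Set} (xs : List A) x ys → length (xs ++ x ∷ ys) ≡ suc (length (xs ++ ys))
    length-++-∷ []       x ys = refl
    length-++-∷ (_ ∷ xs) x ys = cong suc (length-++-∷ xs x ys)

    BalancedReorientation : List Edge → Set
    BalancedReorientation E = ∃ λ O → Reorientation E O × Balanced O

    reorient : ∀ fuel E → length E ≤ fuel → BalancedReorientation E
    reorient _          []            _          = [] , [] , λ v → z≤n , z≤n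
    reorient (suc fuel) ((x , y) ∷ E) (s≤s len≤) with meets? y E
    ... | inj₁ avoid = pendant (reorient fuel E len≤)
      where
      pendant : BalancedReorientation E → BalancedReorientation ((x , y) ∷ E)
      pendant (O , rs , bal) with outdeg-avoided (Reorientation-avoids rs avoid)
                                | indeg-avoided (Reorientation-avoids rs avoid)
                                | ≤-total (outdeg O x) (indeg O x)
      ... | out≡0 | in≡0 | inj₁ out≤in =
        (x , y) ∷ O , inj₁ refl ∷ rs , Balanced-∷ O bal out≤in (≤-reflexive (trans in≡0 (sym out≡0)))
      ... | out≡0 | in≡0 | inj₂ in≤out =
        (y , x) ∷ O , inj₂ refl ∷ rs , Balanced-∷ O bal (≤-reflexive (trans out≡0 (sym in≡0))) in≤out
    ... | inj₂ (meets A z B r) =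
      shortcut (reorient fuel ((x , z) ∷ A ++ B) (subst (_≤ fuel) (length-++-∷ A _ B) len≤))
      where
      shortcut : BalancedReorientation ((x , z) ∷ A ++ B) → BalancedReorientation ((x , y) ∷ A ++ _ ∷ B)
      shortcut (_ ∷ _ , r₀ ∷ rs , bal) with Reorientation-++⁻ A rs
      shortcut (_ ∷ _ , inj₁ refl ∷ rs , bal) | OA , OB , refl , ra , rb =
        (x , y) ∷ OA ++ (y , z) ∷ OB , inj₁ refl ∷ Pointwise.++⁺ ra (SameEnds-sym r ∷ rb) ,
        Balanced-splice _ _ (x , z) y OA OB (λ v → refl) (λ v → +-comm (𝟙 (y ≐ v)) _) bal
      shortcut (_ ∷ _ , inj₂ refl ∷ rs , bal) | OA , OB , refl , ra , rb =
        (y , x) ∷ OA ++ (z , y) ∷ OB , inj₂ refl ∷ Pointwise.++⁺ ra (SameEnds-swap r ∷ rb) ,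
        Balanced-splice _ _ (z , x) y OA OB (λ v → +-comm (𝟙 (y ≐ v)) _) (λ v → refl) bal

  balancedReorientation : ∀ E → ∃ λ O → Reorientation E O × Balanced O
  balancedReorientation E = reorient (length E) E ≤-refl

  orient : (Edge → Bool) → Edge → Edge
  orient σ e = if σ e then e else swap e

  private
    _≟ₑ_ : DecidableEquality Edge
    _≟ₑ_ = ×.≡-dec _≟_ _≟_

    kept : ∀ {e o} → SameEnds e o → Bool
    kept (inj₁ _) = true
    kept (inj₂ _) = false

    keeps : ∀ {E O} → Reorientation E O → Edge → Bool
    keeps                []       _  = true
    keeps {E = e ∷ _} (r ∷ rs) e' = if does (e ≟ₑ e') then kept r else keeps rs e'

    map-orient-keeps : ∀ {E O} → Unique E → (rs : Reorientation E O) → map (orient (keeps rs)) E ≡ O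
    map-orient-keeps                 []          []       = refl
    map-orient-keeps {E = e ∷ E} (e∉E ∷ uniq) (r ∷ rs) =
      cong₂ _∷_ (orient-head r) (trans (map-cong-local (All.map orient-tail e∉E)) (map-orient-keeps uniq rs))
      where
      orient-head : ∀ {o} (r' : SameEnds e o) → orient (keeps (r' ∷ rs)) e ≡ o
      orient-head r' rewrite dec-true (e ≟ₑ e) refl with r'
      ... | inj₁ refl = refl
      ... | inj₂ refl = refl
      orient-tail : ∀ {e'} → e ≢ e' → orient (keeps (r ∷ rs)) e' ≡ orient (keeps rs) e'
      orient-tail {e'} e≢e' rewrite dec-false (e ≟ₑ e') e≢e' = refl

  balancedOrientation : ∀ E → Unique E → ∃ λ σ → Balanced (map (orient σ) E)
  balancedOrientation E uniq with balancedReorientation E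
  ... | O , rs , bal = keeps rs , subst Balanced (sym (map-orient-keeps uniq rs)) bal

module Colouring {V : Set} (_≟_ : DecidableEquality V) where

  open Multigraph _≟_
  private module Cover = Multigraph (⊎.≡-dec _≟_ _≟_)

  doubleCover : Edge → Cover.Edge
  doubleCover e = inj₁ (proj₁ e) , inj₂ (proj₂ e)

  doubleCover-injective : ∀ {e e'} → doubleCover e ≡ doubleCover e' → e ≡ e'
  doubleCover-injective refl = refl

  deg-cover : ∀ σ E v → deg[ σ ∘ doubleCover ] E v ≡
    Cover.outdeg (map (Cover.orient σ) (map doubleCover E)) (inj₁ v) +
    Cover.indeg  (map (Cover.orient σ) (map doubleCover E)) (inj₂ v)
  deg-cover σ []      v = refl
  deg-cover σ (e ∷ E) v with σ (doubleCover e)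
  ... | true  = trans (cong (inc v e +_) (deg-cover σ E v)) (interchange (𝟙 (proj₁ e ≐ v)) (𝟙 (proj₂ e ≐ v)) _ _)
  ... | false = deg-cover σ E v

  deg-cover-not : ∀ σ E v → deg[ not ∘ σ ∘ doubleCover ] E v ≡
    Cover.indeg  (map (Cover.orient σ) (map doubleCover E)) (inj₁ v) +
    Cover.outdeg (map (Cover.orient σ) (map doubleCover E)) (inj₂ v)
  deg-cover-not σ []      v = refl
  deg-cover-not σ (e ∷ E) v with σ (doubleCover e)
  ... | true  = deg-cover-not σ E v
  ... | false = trans (cong (inc v e +_) (deg-cover-not σ E v)) (interchange (𝟙 (proj₁ e ≐ v)) (𝟙 (proj₂ e ≐ v)) _ _)

  twoColouring : ∀ E → Unique E → ∃ λ χ → ∀ v → Near 2 (deg[ χ ] E v) (deg[ not ∘ χ ] E v)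
  twoColouring E uniq with Cover.balancedOrientation (map doubleCover E) (Unique.map⁺ doubleCover-injective uniq)
  ... | σ , bal = σ ∘ doubleCover , λ v →
    subst₂ (Near 2) (sym (deg-cover σ E v)) (sym (deg-cover-not σ E v))
      (Near-+ {d = 1} {d' = 1} (bal (inj₁ v)) (swap (bal (inj₂ v))))

  NearlyEquitable : ℕ → (Edge → ℕ) → List Edge → Set
  NearlyEquitable m χ E = ∀ v c → m * deg[ χ ⁻¹ c ] E v + 2 ≤ deg E v + 2 * m

  interleave : (Edge → Bool) → (Edge → ℕ) → (Edge → ℕ) → Edge → ℕ
  interleave χ₁ χt χf e = if χ₁ e then 2 * χt e else suc (2 * χf e)

  interleave⁻¹-even : ∀ χ₁ χt χf h → interleave χ₁ χt χf ⁻¹ (2 * h) ≗ (λ e → χ₁ e ∧ (χt ⁻¹ h) e)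
  interleave⁻¹-even χ₁ χt χf h e with χ₁ e
  ... | true  = 2*-≟ (χt e) h
  ... | false = dec-false (suc (2 * χf e) ≟ℕ 2 * h) (even≢odd h (χf e) ∘ sym)

  interleave⁻¹-odd : ∀ χ₁ χt χf h → interleave χ₁ χt χf ⁻¹ suc (2 * h) ≗ (λ e → not (χ₁ e) ∧ (χf ⁻¹ h) e)
  interleave⁻¹-odd χ₁ χt χf h e with χ₁ e
  ... | true  = dec-false (2 * χt e ≟ℕ suc (2 * h)) (even≢odd (χt e) h)
  ... | false = 2*-≟ (χf e) h   -- does (suc m ≟ℕ suc n) reduces to does (m ≟ℕ n)

  dyadicColouring : ∀ j E → Unique E → ∃ λ χ → (∀ e → χ e < 2 ^ j) × NearlyEquitable (2 ^ j) χ E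
  dyadicColouring zero E _ = (λ _ → 0) , (λ _ → s≤s z≤n) ,
    λ v c → +-monoˡ-≤ 2 (subst (_≤ deg E v) (sym (*-identityˡ _)) (deg[]≤deg _ E v))
  dyadicColouring (suc j) E uniq with twoColouring E uniq
  ... | χ₁ , near with dyadicColouring j (filter (T? ∘ χ₁) E) (Unique.filter⁺ (T? ∘ χ₁) uniq)
                     | dyadicColouring j (filter (T? ∘ not ∘ χ₁) E) (Unique.filter⁺ (T? ∘ not ∘ χ₁) uniq)
  ... | χt , χt< , equitableᵗ | χf , χf< , equitableᶠ = χ , χ< , equitable
    where
    χ : Edge → ℕ
    χ = interleave χ₁ χt χf
    Et = filter (T? ∘ χ₁) E
    Ef = filter (T? ∘ not ∘ χ₁) E

    χ< : ∀ e → χ e < 2 ^ suc j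
    χ< e with χ₁ e
    ... | true  = ≤-trans (n≤1+n _) (m<n⇒1+2m<2n (χt< e))
    ... | false = m<n⇒1+2m<2n (χf< e)

    halves : ∀ v → deg E v ≡ deg Et v + deg Ef v
    halves v = trans (deg-split χ₁ E v) (sym (cong₂ _+_ (deg-filter χ₁ E v) (deg-filter (not ∘ χ₁) E v)))

    halves-near : ∀ v → Near 2 (deg Et v) (deg Ef v)
    halves-near v = subst₂ (Near 2) (sym (deg-filter χ₁ E v)) (sym (deg-filter (not ∘ χ₁) E v)) (near v)

    equitable : NearlyEquitable (2 ^ suc j) χ E
    equitable v c with parity c
    ... | h , inj₁ refl = begin
      2 ^ suc j * deg[ χ ⁻¹ (2 * h) ] E v + 2  ≡⟨ cong (λ d → 2 ^ suc j * d + 2) even-class ⟩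
      2 ^ suc j * deg[ χt ⁻¹ h ] Et v + 2      ≤⟨ halving-step (2 ^ j) _ _ _ (equitableᵗ v h) (proj₁ (halves-near v)) ⟩
      deg Et v + deg Ef v + 2 * 2 ^ suc j      ≡⟨ cong (_+ 2 * 2 ^ suc j) (halves v) ⟨
      deg E v + 2 * 2 ^ suc j                  ∎
      where
      open ≤-Reasoning
      even-class : deg[ χ ⁻¹ (2 * h) ] E v ≡ deg[ χt ⁻¹ h ] Et v
      even-class = trans (deg[]-cong (interleave⁻¹-even χ₁ χt χf h) E v) (sym (deg[]-filter (χt ⁻¹ h) χ₁ E v))
    ... | h , inj₂ refl = begin
      2 ^ suc j * deg[ χ ⁻¹ suc (2 * h) ] E v + 2  ≡⟨ cong (λ d → 2 ^ suc j * d + 2) odd-class ⟩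
      2 ^ suc j * deg[ χf ⁻¹ h ] Ef v + 2          ≤⟨ halving-step (2 ^ j) _ _ _ (equitableᶠ v h) (proj₂ (halves-near v)) ⟩
      deg Ef v + deg Et v + 2 * 2 ^ suc j          ≡⟨ cong (_+ 2 * 2 ^ suc j) (trans (+-comm (deg Ef v) _) (sym (halves v))) ⟩
      deg E v + 2 * 2 ^ suc j                      ∎
      where
      open ≤-Reasoning
      odd-class : deg[ χ ⁻¹ suc (2 * h) ] E v ≡ deg[ χf ⁻¹ h ] Ef v
      odd-class = trans (deg[]-cong (interleave⁻¹-odd χ₁ χt χf h) E v) (sym (deg[]-filter (χf ⁻¹ h) (not ∘ χ₁) E v))


  majorityColouring : ∀ k E → Unique E → ∃ λ (μ : Edge → Fin (suc k)) →
    ∀ v a → Parameters.threshold k ≤ deg E v → k * deg[ μ ⁻¹ᶠ a ] E v ≤ deg E v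
  majorityColouring k E uniq with dyadicColouring (suc k * suc k) E uniq
  ... | χ , χ<N , equitable = μ , λ v a large → majority-arith {k} {B} {N} (merged v a) k*B<N large
    where
    open Parameters k

    μ : Edge → Fin (suc k)
    μ e = fromℕ< (quotient< (χ<N e))

    μ⁻¹ᶠ-quotient : ∀ a → μ ⁻¹ᶠ a ≗ (λ e → does (χ e / B ≟ℕ toℕ a))
    μ⁻¹ᶠ-quotient a e = does-⇔ (mk⇔ (λ eq → trans (sym (toℕ-fromℕ< (quotient< (χ<N e)))) (cong toℕ eq))
                                    (λ eq → toℕ-injective (trans (toℕ-fromℕ< (quotient< (χ<N e))) eq)))
                               (μ e ≟ᶠ a) (χ e / B ≟ℕ toℕ a)

    merged : ∀ v a → N * deg[ μ ⁻¹ᶠ a ] E v ≤ B * (deg E v + 2 * N)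
    merged v a = begin
      N * deg[ μ ⁻¹ᶠ a ] E v                           ≡⟨ cong (N *_) (deg[]-cong (μ⁻¹ᶠ-quotient a) E v) ⟩
      N * deg[ (λ e → does (χ e / B ≟ℕ toℕ a)) ] E v   ≤⟨ *-monoʳ-≤ N blocks ⟩
      N * ∑[ i < B ] deg[ χ ⁻¹ colour i ] E v          ≡⟨ *-distribˡ-sum {B} N (λ i → deg[ χ ⁻¹ colour i ] E v) ⟩
      ∑[ i < B ] (N * deg[ χ ⁻¹ colour i ] E v)        ≤⟨ ∑-bounded {B} _ _ (λ i → ≤-trans (m≤m+n _ 2)
                                                                                              (equitable v (colour i))) ⟩
      B * (deg E v + 2 * N)                            ∎
      where
      open ≤-Reasoning
      colour : Fin B → ℕ
      colour i = toℕ a * B + toℕ i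
      blocks : deg[ (λ e → does (χ e / B ≟ℕ toℕ a)) ] E v ≤ ∑[ i < B ] deg[ χ ⁻¹ colour i ] E v
      blocks = ≤-trans (∑ˡ-mono-≤ (λ e → block-bound (χ e) (toℕ a) B (inc v e)) E)
                       (≤-reflexive (∑ˡ-∑-comm {m = B} (λ e i → if (χ ⁻¹ colour i) e then inc v e else 0) E))

module EdgeList {n : ℕ} (G : SimpleGraph n) where
  open Multigraph (_≟ᶠ_ {n})

  listed : Edge → Bool
  listed e = does (proj₁ e <? proj₂ e) ∧ adj G (proj₁ e) (proj₂ e)

  edges : List Edge
  edges = filter (T? ∘ listed) (cartesianProduct (allFin n) (allFin n))

  edges-unique : Unique edges
  edges-unique = Unique.filter⁺ (T? ∘ listed) (Unique.cartesianProduct⁺ (Unique.allFin⁺ n) (Unique.allFin⁺ n))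

  edgeOf : Fin n → Fin n → Edge
  edgeOf u v with <-cmp u v
  ... | tri< _ _ _ = u , v
  ... | tri≈ _ _ _ = u , v
  ... | tri> _ _ _ = v , u

  edgeOf-sym : ∀ u v → edgeOf u v ≡ edgeOf v u
  edgeOf-sym u v with <-cmp u v | <-cmp v u
  ... | tri< _   _   _   | tri> _ _ _      = refl
  ... | tri> _   _   _   | tri< _ _ _      = refl
  ... | tri≈ _   refl _  | tri≈ _ _ _      = refl
  ... | tri< _   _   v≮u | tri< v<u _ _    = ⊥-elim (v≮u v<u)
  ... | tri< _   u≢v _   | tri≈ _ v≡u _    = ⊥-elim (u≢v (sym v≡u))
  ... | tri≈ _   _   v≮u | tri< v<u _ _    = ⊥-elim (v≮u v<u)
  ... | tri≈ u≮v _   _   | tri> _ _ u<v    = ⊥-elim (u≮v u<v)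
  ... | tri> _   u≢v _   | tri≈ _ v≡u _    = ⊥-elim (u≢v (sym v≡u))
  ... | tri> u≮v _   _   | tri> _ _ u<v    = ⊥-elim (u≮v u<v)

  deg[]-edges : ∀ w u → deg[ w ] edges u ≡ ∑[ v < n ] 𝟙 (adj G u v ∧ w (edgeOf u v))
  deg[]-edges w u = begin
    deg[ w ] edges u
      ≡⟨ ∑ˡ-filter listed _ (cartesianProduct (allFin n) (allFin n)) ⟩
    ∑[ p ∈ cartesianProduct (allFin n) (allFin n) ] F p
      ≡⟨ ∑ˡ-cartesianProduct F (allFin n) (allFin n) ⟩
    ∑[ x ∈ allFin n ] ∑[ y ∈ allFin n ] F (x , y)
      ≡⟨ trans (∑ˡ-tabulate id (λ x → ∑[ y ∈ allFin n ] F (x , y)))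
               (sum-cong-≗ (λ x → ∑ˡ-tabulate id (λ y → F (x , y)))) ⟩
    ∑[ x < n ] ∑[ y < n ] F (x , y)
      ≡⟨ sum-cong-≗ (λ x → trans (sum-cong-≗ (F-split x)) (∑-distrib-+ (atTail x) (atHead x))) ⟩
    ∑[ x < n ] (∑[ y < n ] atTail x y + ∑[ y < n ] atHead x y)
      ≡⟨ ∑-distrib-+ (λ x → ∑[ y < n ] atTail x y) (λ x → ∑[ y < n ] atHead x y) ⟩
    ∑[ x < n ] ∑[ y < n ] atTail x y + ∑[ x < n ] ∑[ y < n ] atHead x y
      ≡⟨ cong₂ _+_ (trans (sum-cong-≗ (λ x → sym (*-distribˡ-sum (𝟙 (x ≐ u)) (g x)))) (∑-δ u _))
                   (sum-cong-≗ (λ x → ∑-δ u (g x))) ⟩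
    ∑[ v < n ] g u v + ∑[ v < n ] g v u
      ≡⟨ ∑-distrib-+ (g u) (λ v → g v u) ⟨
    ∑[ v < n ] (g u v + g v u)
      ≡⟨ sum-cong-≗ incident ⟩
    ∑[ v < n ] 𝟙 (adj G u v ∧ w (edgeOf u v)) ∎
    where
    open ≡-Reasoning
    F : Edge → ℕ
    F p = if listed p then (if w p then inc u p else 0) else 0

    g : Fin n → Fin n → ℕ
    g x y = 𝟙 (listed (x , y) ∧ w (x , y))

    atTail atHead : Fin n → Fin n → ℕ
    atTail x y = 𝟙 (x ≐ u) * g x y
    atHead x y = 𝟙 (y ≐ u) * g x y

    F-split : ∀ x y → F (x , y) ≡ atTail x y + atHead x y
    F-split x y with listed (x , y) | w (x , y)
    ... | true  | true  = sym (cong₂ _+_ (*-identityʳ (𝟙 (x ≐ u))) (*-identityʳ (𝟙 (y ≐ u))))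
    ... | true  | false = sym (cong₂ _+_ (*-zeroʳ (𝟙 (x ≐ u))) (*-zeroʳ (𝟙 (y ≐ u))))
    ... | false | _     = sym (cong₂ _+_ (*-zeroʳ (𝟙 (x ≐ u))) (*-zeroʳ (𝟙 (y ≐ u))))

    incident : ∀ v → g u v + g v u ≡ 𝟙 (adj G u v ∧ w (edgeOf u v))
    incident v with <-cmp u v
    ... | tri< u<v _ _ rewrite dec-true (u <? v) u<v | dec-false (v <? u) (<-asym u<v) = +-identityʳ _
    ... | tri≈ u≮v refl _ rewrite dec-false (u <? u) u≮v | loopless G u = refl
    ... | tri> u≮v _ v<u rewrite dec-false (u <? v) u≮v | dec-true (v <? u) v<u | symmetric G u v = refl

  degree≡deg : ∀ u → degree G u ≡ deg edges u
  degree≡deg u = begin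
    degree G u                          ≡⟨ length-filter-allFin (adj G u) ⟩
    ∑[ v < n ] 𝟙 (adj G u v)            ≡⟨ sum-cong-≗ (λ v → cong 𝟙 (∧-identityʳ (adj G u v))) ⟨
    ∑[ v < n ] 𝟙 (adj G u v ∧ true)     ≡⟨ deg[]-edges (λ _ → true) u ⟨
    deg edges u                         ∎
    where open ≡-Reasoning

  colouringOf : ∀ {m} → (Edge → Fin m) → EdgeColoring G m
  colouringOf μ = record { col = λ u v _ → μ (edgeOf u v) ; col-sym = λ u v _ _ → cong μ (edgeOf-sym u v) }

  hasColor-colouringOf : ∀ {m} (μ : Edge → Fin m) u a v →
                         hasColor (colouringOf μ) u a v ≡ adj G u v ∧ (μ ⁻¹ᶠ a) (edgeOf u v)
  hasColor-colouringOf μ u a v with T? (adj G u v)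
  ... | yes uv rewrite dec-true (T? (adj G u v)) uv = isYes≗does _
  ... | no ¬uv rewrite dec-false (T? (adj G u v)) ¬uv = refl

  colorDegree≡deg[] : ∀ {m} (μ : Edge → Fin m) u a → colorDegree (colouringOf μ) u a ≡ deg[ μ ⁻¹ᶠ a ] edges u
  colorDegree≡deg[] μ u a = begin
    colorDegree (colouringOf μ) u a                   ≡⟨ length-filter-allFin (hasColor (colouringOf μ) u a) ⟩
    ∑[ v < n ] 𝟙 (hasColor (colouringOf μ) u a v)     ≡⟨ sum-cong-≗ (cong 𝟙 ∘ hasColor-colouringOf μ u a) ⟩
    ∑[ v < n ] 𝟙 (adj G u v ∧ (μ ⁻¹ᶠ a) (edgeOf u v)) ≡⟨ deg[]-edges (μ ⁻¹ᶠ a) u ⟨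
    deg[ μ ⁻¹ᶠ a ] edges u                            ∎
    where open ≡-Reasoning

-- The construction works for every k.
theorem4 : (k : ℕ) → 2 ≤ k →
    Σ ℕ (λ δ → 0 < δ × (∀ (n : ℕ) (G : SimpleGraph n) → MinDegreeAtLeast G δ →
      Σ (EdgeColoring G (suc k)) (λ c → IsMajorityColoring k c)))
theorem4 k _ = threshold , s≤s z≤n , λ n G minDeg →
  let open EdgeList G
      μ , majority = Colouring.majorityColouring _≟ᶠ_ k edges edges-unique
  in colouringOf μ , λ u a →
       subst₂ (λ c d → k * c ≤ d) (sym (colorDegree≡deg[] μ u a)) (sym (degree≡deg u))
         (majority u a (subst (threshold ≤_) (degree≡deg u) (minDeg u)))
  where open Parameters k
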